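{- Let $k\ge 3$, $\tau\in\mathcal{S}_k$ with $\tau(k-1)=k-1$, $\tau(k)=k$, and $\widetilde\tau$ as in the context. For every forest $F$ on $[n]$, the forest $\alpha(F)$ avoids $\tau$ and the forest $\beta(F)$ avoids $\widetilde\tau$.
   Context: Forests on $[n]$ are unordered rooted forests with vertices labeled bijectively by $[n]$. An instance of a pattern $\rho\in\mathcal{S}_j$ is a sequence $v_1,\dots,v_j$ of vertices with $v_a$ a strict ancestor of $v_b$ for $a<b$ and labels in the same relative order as $\rho$; $v_j$ is its endpoint; avoiding $\rho$ means having no instance. Let $\widetilde\tau(i)=\tau(i)$ for $i\le k-2$, $\widetilde\tau(k-1)=k$, $\widetilde\tau(k)=k-1$, and $\bar\tau\in\mathcal{S}_{k-1}$ with $\bar\tau(i)=\tau(i)$ for $i\le k-2$, $\bar\tau(k-1)=k-1$. A vertex is special if it is the endpoint of an instance of $\bar\tau$. For special $v$ with subtree label set $L$ (labels of all descendants of $v$ including $v$), let $x=\max L$ and let $y$ be the least element of $L$ such that $v$ would remain special if labeled $y$. Shuffling $v$ means labeling $v$ by $x$ and relabeling its strict descendants by $L\setminus\{x\}$ preserving their relative order; antishuffling $v$ means labeling $v$ by $y$ and relabeling its strict descendants by $L\setminus\{y\}$ preserving relative order. The map $\alpha$: traverse the vertices of $F$ in reverse breadth-first order (so each vertex is visited after all its strict descendants, ending with the roots), and shuffle each visited vertex that is special; the result is $\alpha(F)$. The map $\beta$: traverse in breadth-first order (each vertex after all its strict ancestors), antishuffling each visited vertex that is special; the result is $\beta(F)$.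 -}

module Defs where

open import Data.Nat using (ℕ; zero; suc; _≤_; _<_; _∸_)
open import Data.Nat.Properties using (m∸n≤m)
import Data.Nat as ℕ
open import Data.Fin using (Fin; toℕ; inject≤)
import Data.Fin as F
open import Data.Fin.Permutation using (Permutation′; _⟨$⟩ʳ_)
open import Data.Maybe using (Maybe; just; nothing; _>>=_)
open import Data.List using (List; []; _∷_; filter; concatMap; reverse; upTo; allFin)
open import Data.Bool using (if_then_else_)
open import Data.Product using (Σ; ∃; _×_; _,_)
open import Data.Sum using (_⊎_)
open import Relation.Nullary using (¬_; does)
open import Relation.Binary.PropositionalEquality using (_≡_; _≢_)

-- Vertices are the elements of Fin n (an arbitrary indexing of the
-- vertices); the shape is a parent function (nothing = root), and the
-- labeling is a bijection Fin n → Fin n (labels 0..n-1 stand for 1..n).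

-- up p m v = the (m+1)-st ancestor of v (if it exists)
up : {n : ℕ} → (Fin n → Maybe (Fin n)) → ℕ → Fin n → Maybe (Fin n)
up p zero v = p v
up p (suc m) v = p v >>= up p m

record Forest (n : ℕ) : Set where
  field
    parent  : Fin n → Maybe (Fin n)
    acyclic : ∀ v → up parent n v ≡ nothing
    label   : Permutation′ n
open Forest public

Parent : ℕ → Set
Parent n = Fin n → Maybe (Fin n)

Labeling : ℕ → Set
Labeling n = Fin n → Fin n

StrictAnc : {n : ℕ} → Parent n → Fin n → Fin n → Set
StrictAnc p u v = ∃ λ m → up p m v ≡ just u

DescOrSelf : {n : ℕ} → Parent n → Fin n → Fin n → Set
DescOrSelf p v w = w ≡ v ⊎ StrictAnc p v w

-- Patterns. A pattern of length j is given by its values ρ : Fin j → ℕ;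
-- only the relative order of the values matters.

IsInstance : {n j : ℕ} → Parent n → Labeling n → (Fin j → ℕ) → (Fin j → Fin n) → Set
IsInstance {j = j} p lab ρ vs =
  (∀ (a b : Fin j) → toℕ a < toℕ b → StrictAnc p (vs a) (vs b)) ×
  (∀ (a b : Fin j) → ρ a < ρ b → toℕ (lab (vs a)) < toℕ (lab (vs b)))

Contains : {n j : ℕ} → Parent n → Labeling n → (Fin j → ℕ) → Set
Contains p lab ρ = ∃ λ vs → IsInstance p lab ρ vs

Avoids : {n j : ℕ} → Parent n → Labeling n → (Fin j → ℕ) → Set
Avoids p lab ρ = ¬ Contains p lab ρ

EndpointOf : {n j : ℕ} → Parent n → Labeling n → (Fin j → ℕ) → Fin n → Set
EndpointOf {j = j} p lab ρ v =
  ∃ λ vs → IsInstance p lab ρ vs × (Σ (Fin j) λ b → suc (toℕ b) ≡ j × vs b ≡ v)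

-- The patterns τ, τ̃, τ̄ (0-indexed positions and values).

pat : {k : ℕ} → Permutation′ k → Fin k → ℕ
pat τ i = toℕ (τ ⟨$⟩ʳ i)

patTilde : {k : ℕ} → Permutation′ k → Fin k → ℕ
patTilde {k} τ i =
  if does (toℕ i ℕ.≟ (k ∸ 2)) then k ∸ 1
  else if does (toℕ i ℕ.≟ (k ∸ 1)) then k ∸ 2
  else toℕ (τ ⟨$⟩ʳ i)

patBar : {k : ℕ} → Permutation′ k → Fin (k ∸ 1) → ℕ
patBar {k} τ i = toℕ (τ ⟨$⟩ʳ inject≤ i (m∸n≤m k 1))

Special : {n k : ℕ} → Permutation′ k → Parent n → Labeling n → Fin n → Set
Special τ p lab v = EndpointOf p lab (patBar τ) v

InL : {n : ℕ} → Parent n → Labeling n → Fin n → Fin n → Set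
InL p lab v ℓ = ∃ λ w → DescOrSelf p v w × lab w ≡ ℓ

relabel : {n : ℕ} → Labeling n → Fin n → Fin n → Labeling n
relabel lab v y w = if does (w F.≟ v) then y else lab w

IsMaxL : {n : ℕ} → Parent n → Labeling n → Fin n → Fin n → Set
IsMaxL p lab v x = InL p lab v x × (∀ ℓ → InL p lab v ℓ → toℕ ℓ ≤ toℕ x)

IsLeastSpecialL : {n k : ℕ} → Permutation′ k → Parent n → Labeling n → Fin n → Fin n → Set
IsLeastSpecialL τ p lab v y =
  InL p lab v y × Special τ p (relabel lab v y) v ×
  (∀ z → InL p lab v z → Special τ p (relabel lab v z) v → toℕ y ≤ toℕ z)

RelabelSubtree : {n : ℕ} → Parent n → Labeling n → Fin n → Fin n → Labeling n → Set
RelabelSubtree p lab v t lab' =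
  lab' v ≡ t ×
  (∀ w → ¬ DescOrSelf p v w → lab' w ≡ lab w) ×
  (∀ w → StrictAnc p v w → InL p lab v (lab' w) × lab' w ≢ t) ×
  (∀ w w' → StrictAnc p v w → StrictAnc p v w' →
     toℕ (lab w) < toℕ (lab w') → toℕ (lab' w) < toℕ (lab' w'))

Shuffle : {n : ℕ} → Parent n → Labeling n → Fin n → Labeling n → Set
Shuffle p lab v lab' = ∃ λ x → IsMaxL p lab v x × RelabelSubtree p lab v x lab'

Antishuffle : {n k : ℕ} → Permutation′ k → Parent n → Labeling n → Fin n → Labeling n → Set
Antishuffle τ p lab v lab' =
  ∃ λ y → IsLeastSpecialL τ p lab v y × RelabelSubtree p lab v y lab'

-- depth = number of strict ancestors (fuel n suffices for forests on [n])
depthF : {n : ℕ} → Parent n → ℕ → Fin n → ℕ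
depthF p zero v = zero
depthF p (suc f) v with p v
... | nothing = zero
... | just u = suc (depthF p f u)

depth : {n : ℕ} → Parent n → Fin n → ℕ
depth {n} p = depthF p n

bfs : {n : ℕ} → Parent n → List (Fin n)
bfs {n} p = concatMap (λ d → filter (λ v → depth p v ℕ.≟ d) (allFin n)) (upTo n)

data Run {n : ℕ} (Step : Fin n → Labeling n → Labeling n → Set)
         : List (Fin n) → Labeling n → Labeling n → Set where
  done : ∀ {lab} → Run Step [] lab lab
  step : ∀ {v vs lab lab' lab''} → Step v lab lab' → Run Step vs lab' lab'' →
         Run Step (v ∷ vs) lab lab''

StepAlpha : {n k : ℕ} → Permutation′ k → Parent n → Fin n → Labeling n → Labeling n → Set
StepAlpha τ p v lab lab' =
  (Special τ p lab v × Shuffle p lab v lab') ⊎ (¬ Special τ p lab v × lab' ≡ lab)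

StepBeta : {n k : ℕ} → Permutation′ k → Parent n → Fin n → Labeling n → Labeling n → Set
StepBeta τ p v lab lab' =
  (Special τ p lab v × Antishuffle τ p lab v lab') ⊎ (¬ Special τ p lab v × lab' ≡ lab)

-- Alpha τ F lab' : lab' is the labeling of α(F) (same shape as F)
Alpha : {n k : ℕ} → Permutation′ k → Forest n → Labeling n → Set
Alpha τ F lab' = Run (StepAlpha τ (parent F)) (reverse (bfs (parent F))) (label F ⟨$⟩ʳ_) lab'

Beta : {n k : ℕ} → Permutation′ k → Forest n → Labeling n → Set
Beta τ F lab' = Run (StepBeta τ (parent F)) (bfs (parent F)) (label F ⟨$⟩ʳ_) lab'

module Submission where

-- A vertex v is special iff some instance ws of τ̄ without its last entry lies strictly above v with
-- all labels below that of v ("v caps ws"). As τ ends with its two largest values, an instance of τ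
-- is a capping vertex followed by a larger descendant, and an instance of τ̃ one followed by a
-- smaller descendant that is still larger than the capped instance.
-- α visits descendants first and keeps, at visited vertices, that a special vertex carries the
-- largest label of its subtree. Shuffling u establishes this at u. It survives at the visited
-- descendants of u: shuffling preserves relative order below u, and it fixes every label smaller
-- than lab u, so a descendant that is special afterwards was special before.
-- β visits ancestors first and keeps that a special vertex is labelled below every descendant that
-- could replace it in capping; antishuffling u gives u the least such label.
-- At the end these invariants hold everywhere, and they exclude τ, resp. τ̃.

open import Defs
open import Data.Nat as ℕ using (ℕ; zero; suc; _+_; _*_; _∸_; _<_; _≤_; z≤n; s≤s)
import Data.Nat.Properties as ℕ
open import Data.Fin as Fin using (Fin; zero; suc; toℕ; fromℕ; fromℕ<; inject₁; opposite)
open import Data.Fin.Properties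
  using (any?; all?; toℕ<n; toℕ-injective; toℕ-fromℕ; toℕ-fromℕ<; toℕ-inject₁; toℕ-inject≤;
         opposite-prop; opposite-involutive; pigeonhole; <-cmp; ≤∧≢⇒<; <-trans; <-irrefl; <-asym)
import Data.Fin.Relation.Unary.Top as Top
open import Data.Fin.Induction using (<-wellFounded; >-wellFounded)
import Data.Vec.Functional as Vector
open import Data.Fin.Permutation using (Permutation′; _⟨$⟩ʳ_)
open import Function.Bundles using (Injection)
open import Function.Properties.Inverse using (↔⇒↣)
open import Data.List using (List; []; _∷_; reverse; filter; upTo; allFin)
open import Data.List.Properties using (unfold-reverse)
open import Data.List.Membership.Propositional using (_∈_)
import Data.List.Membership.Propositional.Properties as ∈
open import Data.List.Relation.Unary.All as All using (All; []; _∷_)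
import Data.List.Relation.Unary.All.Properties as All
open import Data.List.Relation.Unary.Any as Any using (here; there)
import Data.List.Relation.Unary.Any.Properties as Any
open import Data.List.Relation.Unary.AllPairs as AllPairs using (AllPairs; []; _∷_)
import Data.List.Relation.Unary.AllPairs.Properties as AllPairs
open import Data.Maybe using (just; nothing)
import Data.Maybe.Properties as Maybe
open import Data.Product using (∃; _×_; _,_; proj₁; proj₂)
open import Data.Sum using (_⊎_; inj₁; inj₂)
open import Data.Empty using (⊥; ⊥-elim)
open import Function using (_∘_; flip; case_of_)
open import Function.Definitions using (Injective)
open import Induction.WellFounded using (WellFounded; Acc; acc)
open import Level using (Level)
open import Relation.Binary using (Rel; tri<; tri≈; tri>)
open import Relation.Binary.PropositionalEquality
open import Relation.Nullary using (¬_; Dec; yes; no)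
import Relation.Nullary.Decidable as Dec
open import Relation.Nullary.Decidable using (dec-true; dec-false; _×-dec_; _⊎-dec_; _→-dec_)
open import Relation.Unary using (Pred; Decidable)

private variable
  n : ℕ
  A : Set
  xs : List A

least : ∀ {p} {P : Pred (Fin n) p} → Decidable P → ∃ P → ∃ λ y → P y × (∀ {z} → P z → y Fin.≤ z)
least {suc n} P? w with P? zero
... | yes P0 = zero , P0 , λ _ → z≤n
... | no ¬P0 with w
...   | zero , P0 = ⊥-elim (¬P0 P0)
...   | suc i , Pi with least (P? ∘ suc) (i , Pi)
...     | y , Py , min = suc y , Py , λ { {zero} P0 → ⊥-elim (¬P0 P0) ; {suc z} Pz → s≤s (min Pz) }

opposite-reverses-< : {i j : Fin n} → i Fin.< j → opposite j Fin.< opposite i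
opposite-reverses-< {i = i} {j} i<j
  rewrite opposite-prop i | opposite-prop j = ℕ.∸-monoʳ-< (s≤s i<j) (toℕ<n j)

opposite-reverses-≤ : {i j : Fin n} → i Fin.≤ j → opposite j Fin.≤ opposite i
opposite-reverses-≤ {n} {i} {j} i≤j
  rewrite opposite-prop i | opposite-prop j = ℕ.∸-monoʳ-≤ n (s≤s i≤j)

opposite² : ∀ {p} (P : Pred (Fin n) p) {i} → P i → P (opposite (opposite i))
opposite² P = subst P (sym (opposite-involutive _))

opposite-injective : {i j : Fin n} → opposite i ≡ opposite j → i ≡ j
opposite-injective {i = i} {j} e =
  trans (sym (opposite-involutive i)) (trans (cong opposite e) (opposite-involutive j))

greatest : ∀ {p} {P : Pred (Fin n) p} → Decidable P → ∃ P → ∃ λ y → P y × (∀ {z} → P z → z Fin.≤ y)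
greatest {P = P} P? (x , Px) with least (P? ∘ opposite) (opposite x , opposite² P Px)
... | y , Py , min = opposite y , Py , λ {z} Pz →
  subst (Fin._≤ opposite y) (opposite-involutive z) (opposite-reverses-≤ (min (opposite² P Pz)))

any-function? : ∀ {p} m {P : (Fin m → Fin n) → Set p} →
  (∀ {f g} → (∀ i → f i ≡ g i) → P f → P g) → (∀ f → Dec (P f)) → Dec (∃ P)
any-function? zero resp P? = Dec.map′ (_ ,_) (λ (f , Pf) → resp (λ ()) Pf) (P? (λ ()))
any-function? (suc m) resp P? =
  Dec.map′ (λ (a , f , Pf) → a Vector.∷ f , Pf)
           (λ (f , Pf) → f zero , f ∘ suc , resp (λ { zero → refl ; (suc i) → refl }) Pf)
           (any? λ a → any-function? m (λ f≗g → resp λ { zero → refl ; (suc i) → f≗g i })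
                                         (λ f → P? (a Vector.∷ f)))

module _ {a r} {A : Set a} {_≺_ : Rel A r} (wf : WellFounded _≺_)
         {v q} {V : Set v} {P : Pred V q} (f g : V → A) where

  no-descent : (∀ {w w′} → P w → P w′ → f w ≺ f w′ → g w ≺ g w′) →
               (∀ {w} → P w → g w ≺ f w → ∃ λ w′ → P w′ × f w′ ≡ g w) →
               ∀ {w} → P w → ¬ g w ≺ f w
  no-descent mono closed {w} = go (wf (f w))
    where
    go : ∀ {w} → Acc _≺_ (f w) → P w → ¬ g w ≺ f w
    go {w} (acc rs) Pw gw≺fw with closed Pw gw≺fw
    ... | w′ , Pw′ , fw′≡gw = go (rs fw′≺fw) Pw′ (subst (g w′ ≺_) (sym fw′≡gw) (mono Pw′ Pw fw′≺fw))
      where fw′≺fw = subst (_≺ f w) (sym fw′≡gw) gw≺fw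

module _ {ℓ : Level} where

  _∖_ : Pred (Fin n) ℓ → Fin n → Pred (Fin n) ℓ
  (L ∖ s) a = L a × a ≢ s

  OrderEmbedding : Pred (Fin n) ℓ → Pred (Fin n) ℓ → (Fin n → Fin n) → Set ℓ
  OrderEmbedding A B g = (∀ {a} → A a → B (g a)) × (∀ {a b} → A a → A b → a Fin.< b → g a Fin.< g b)

  module _ {L : Pred (Fin n) ℓ} (L? : Decidable L) where

    -- for s < t, labels in (s, t] move down to their predecessor in L
    ∖-embedding-< : ∀ {s t} → L s → s Fin.< t → ∃ (OrderEmbedding (L ∖ s) (L ∖ t))
    ∖-embedding-< {s} {t} Ls s<t = g , into , mono
      where
      predecessor : ∀ a → s Fin.< a → ∃ λ c → (L c × c Fin.< a) × (∀ {z} → L z × z Fin.< a → z Fin.≤ c)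
      predecessor a s<a = greatest (λ c → L? c ×-dec (toℕ c ℕ.<? toℕ a)) (s , Ls , s<a)

      pred : ∀ a → s Fin.< a → Fin n
      pred a s<a = proj₁ (predecessor a s<a)

      pred∈ : ∀ a s<a → L (pred a s<a) × pred a s<a Fin.< a
      pred∈ a s<a = proj₁ (proj₂ (predecessor a s<a))

      pred-max : ∀ a s<a {z} → L z → z Fin.< a → z Fin.≤ pred a s<a
      pred-max a s<a Lz z<a = proj₂ (proj₂ (predecessor a s<a)) (Lz , z<a)

      shifted? : ∀ a → Dec (s Fin.< a × a Fin.≤ t)
      shifted? a = (toℕ s ℕ.<? toℕ a) ×-dec (toℕ a ℕ.≤? toℕ t)

      shift : ∀ a → Dec (s Fin.< a × a Fin.≤ t) → Fin n
      shift a (yes (s<a , _)) = pred a s<a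
      shift a (no _)          = a

      g : Fin n → Fin n
      g a = shift a (shifted? a)

      into′ : ∀ {a} (d : Dec (s Fin.< a × a Fin.≤ t)) → (L ∖ s) a → (L ∖ t) (shift a d)
      into′ {a} (yes (s<a , a≤t)) _ =
        proj₁ (pred∈ a s<a) , λ pred≡t → ℕ.<⇒≱ (subst (Fin._< a) pred≡t (proj₂ (pred∈ a s<a))) a≤t
      into′ (no ¬shifted) (La , _) = La , λ { refl → ¬shifted (s<t , ℕ.≤-refl) }

      into : ∀ {a} → (L ∖ s) a → (L ∖ t) (g a)
      into {a} = into′ (shifted? a)

      mono′ : ∀ {a b} (da : Dec (s Fin.< a × a Fin.≤ t)) (db : Dec (s Fin.< b × b Fin.≤ t)) →
              (L ∖ s) a → (L ∖ s) b → a Fin.< b → shift a da Fin.< shift b db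
      mono′ {a} {b} (yes (s<a , _)) (yes (s<b , _)) (La , _) _ a<b =
        ℕ.<-≤-trans (proj₂ (pred∈ a s<a)) (pred-max b s<b La a<b)
      mono′ {a} (yes (s<a , _)) (no _) _ _ a<b = <-trans (proj₂ (pred∈ a s<a)) a<b
      mono′ {a} {b} (no ¬shifted) (yes (s<b , b≤t)) (_ , a≢s) _ a<b =
        ℕ.<-≤-trans a<s (pred-max b s<b Ls s<b)
        where
        a<s : a Fin.< s
        a<s = ≤∧≢⇒< (ℕ.≮⇒≥ λ s<a → ¬shifted (s<a , ℕ.≤-trans (ℕ.<⇒≤ a<b) b≤t)) a≢s
      mono′ (no _) (no _) _ _ a<b = a<b

      mono : ∀ {a b} → (L ∖ s) a → (L ∖ s) b → a Fin.< b → g a Fin.< g b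
      mono {a} {b} = mono′ (shifted? a) (shifted? b)

  ∖-embedding : ∀ {L : Pred (Fin n) ℓ} → Decidable L → ∀ {s t} → L s → L t →
                ∃ (OrderEmbedding (L ∖ s) (L ∖ t))
  ∖-embedding {L = L} L? {s} {t} Ls Lt with <-cmp s t
  ... | tri< s<t _ _ = ∖-embedding-< L? Ls s<t
  ... | tri≈ _ refl _ = (λ a → a) , (λ a∈ → a∈) , (λ _ _ a<b → a<b)
  ... | tri> _ _ t<s
    with ∖-embedding-< (L? ∘ opposite) (opposite² L Ls) (opposite-reverses-< t<s)
  ...   | g , into , mono = opposite ∘ g ∘ opposite , into′ , mono′
    where
    back : ∀ {a} → (L ∖ s) a → ((L ∘ opposite) ∖ opposite s) (opposite a)
    back {a} (La , a≢s) = opposite² L La , λ e → a≢s (opposite-injective e)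
    into′ : ∀ {a} → (L ∖ s) a → (L ∖ t) (opposite (g (opposite a)))
    into′ a∈ with into (back a∈)
    ... | Lc , c≢t = Lc , λ e → c≢t (trans (sym (opposite-involutive _)) (cong opposite e))
    mono′ : ∀ {a b} → (L ∖ s) a → (L ∖ s) b → a Fin.< b →
            (opposite ∘ g ∘ opposite) a Fin.< (opposite ∘ g ∘ opposite) b
    mono′ a∈ b∈ a<b = opposite-reverses-< (mono (back b∈) (back a∈) (opposite-reverses-< a<b))

All-reverse : {P : A → Set} → All P xs → All P (reverse xs)
All-reverse [] = []
All-reverse {xs = x ∷ xs} (px ∷ pxs) rewrite unfold-reverse x xs = All.∷ʳ⁺ (All-reverse pxs) px

AllPairs-reverse : {R : A → A → Set} → AllPairs R xs → AllPairs (flip R) (reverse xs)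
AllPairs-reverse [] = []
AllPairs-reverse {xs = x ∷ xs} (rx ∷ rxs) rewrite unfold-reverse x xs =
  AllPairs.++⁺ (AllPairs-reverse rxs) ([] ∷ []) (All.map (_∷ []) (All-reverse rx))

data SuccessorsFollow {A : Set} (R : A → A → Set) : List A → Set where
  [] : SuccessorsFollow R []
  _∷_ : ∀ {u post} → (∀ {x} → R u x → x ∈ post) → SuccessorsFollow R post →
        SuccessorsFollow R (u ∷ post)

successors-follow : {Q R : A → A → Set} → (∀ {a b} → Q a b → ¬ R b a) → (∀ {a} → ¬ R a a) →
                    AllPairs Q xs → (∀ {y x} → y ∈ xs → R y x → x ∈ xs) → SuccessorsFollow R xs
successors-follow Q⇒¬R R-irrefl [] _ = []
successors-follow {xs = u ∷ post} {R = R} Q⇒¬R R-irrefl (Qu ∷ Qpost) closed =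
  after ∷ successors-follow Q⇒¬R R-irrefl Qpost closed′
  where
  after : ∀ {x} → R u x → x ∈ post
  after Rux with closed (here refl) Rux
  ... | here refl = ⊥-elim (R-irrefl Rux)
  ... | there x∈ = x∈
  closed′ : ∀ {y x} → y ∈ post → R y x → x ∈ post
  closed′ y∈ Ryx with closed (there y∈) Ryx
  ... | here refl = ⊥-elim (Q⇒¬R (All.lookup Qu y∈) Ryx)
  ... | there x∈ = x∈

module Ancestry {n : ℕ} (p : Parent n) (acyclic : ∀ v → up p n v ≡ nothing) where

  up-nothing-mono : ∀ {m M a} → up p m a ≡ nothing → m ≤ M → up p M a ≡ nothing
  up-nothing-mono {zero} {zero} e _ = e
  up-nothing-mono {zero} {suc M} {a} e _ rewrite e = refl
  up-nothing-mono {suc m} {suc M} {a} e (s≤s m≤M) with p a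
  ... | nothing = refl
  ... | just c = up-nothing-mono e m≤M

  up-+ : ∀ m {a b} → up p m a ≡ just b → ∀ d → up p (suc m + d) a ≡ up p d b
  up-+ zero e d rewrite e = refl
  up-+ (suc m) {a} e d with p a
  ... | just c = up-+ m e d

  up-later : ∀ {i j v a b} → up p i v ≡ just a → up p j v ≡ just b → i < j → StrictAnc p b a
  up-later {i} {j} {v} e₁ e₂ i<j =
    j ∸ suc i ,
    trans (sym (up-+ i e₁ (j ∸ suc i))) (trans (cong (λ x → up p x v) (ℕ.m+[n∸m]≡n i<j)) e₂)

  up-cycle : ∀ {m a} → up p m a ≡ just a → ∀ r → up p (r * suc m + m) a ≡ just a
  up-cycle e zero = e
  up-cycle {m} {a} e (suc r) =
    trans (cong (λ x → up p x a) (ℕ.+-assoc (suc m) (r * suc m) m))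
          (trans (up-+ m e (r * suc m + m)) (up-cycle e r))

  -- iterating a cycle through a yields an (n+1)-st ancestor of a, which does not exist
  anc-irrefl : ∀ {a} → ¬ StrictAnc p a a
  anc-irrefl {a} (m , e)
    with () ← trans (sym (up-nothing-mono (acyclic a) (ℕ.≤-trans (ℕ.m≤m*n n (suc m)) (ℕ.m≤m+n _ m))))
                    (up-cycle e n)

  anc-trans : ∀ {a b c} → StrictAnc p a b → StrictAnc p b c → StrictAnc p a c
  anc-trans (m₂ , e₂) (m₁ , e₁) = suc m₁ + m₂ , trans (up-+ m₁ e₁ m₂) e₂

  anc⇒≢ : ∀ {a b} → StrictAnc p a b → a ≢ b
  anc⇒≢ ab refl = anc-irrefl ab

  anc-comparable : ∀ {a b w} → StrictAnc p a w → StrictAnc p b w →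
                   a ≡ b ⊎ StrictAnc p a b ⊎ StrictAnc p b a
  anc-comparable (i , e₁) (j , e₂) with ℕ.<-cmp i j
  ... | tri< i<j _ _ = inj₂ (inj₂ (up-later e₁ e₂ i<j))
  ... | tri≈ _ refl _ = inj₁ (Maybe.just-injective (trans (sym e₁) e₂))
  ... | tri> _ _ j<i = inj₂ (inj₁ (up-later e₂ e₁ j<i))

  up-index-< : ∀ {m a b} → up p m b ≡ just a → m < n
  up-index-< {m} {b = b} e with m ℕ.<? n
  ... | yes m<n = m<n
  ... | no m≮n with trans (sym e) (up-nothing-mono (acyclic b) (ℕ.≮⇒≥ m≮n))
  ... | ()

  anc? : ∀ a b → Dec (StrictAnc p a b)
  anc? a b = Dec.map′ (λ (i , e) → toℕ i , e) from
                      (any? λ i → Maybe.≡-dec Fin._≟_ (up p (toℕ i) b) (just a))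
    where
    from : StrictAnc p a b → ∃ λ (i : Fin n) → up p (toℕ i) b ≡ just a
    from (m , e) = fromℕ< m<n , subst (λ x → up p x b ≡ just a) (sym (toℕ-fromℕ< m<n)) e
      where m<n = up-index-< {m} e

  desc? : ∀ v w → Dec (DescOrSelf p v w)
  desc? v w = (w Fin.≟ v) ⊎-dec anc? v w

  descOrSelf-anc-trans : ∀ {u a x} → DescOrSelf p u a → StrictAnc p a x → DescOrSelf p u x
  descOrSelf-anc-trans (inj₁ refl) a<x = inj₂ a<x
  descOrSelf-anc-trans (inj₂ u<a) a<x = inj₂ (anc-trans u<a a<x)

  anc-descOrSelf-trans : ∀ {x u w} → StrictAnc p x u → DescOrSelf p u w → StrictAnc p x w
  anc-descOrSelf-trans x<u (inj₁ refl) = x<u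
  anc-descOrSelf-trans x<u (inj₂ u<w) = anc-trans x<u u<w

  descOrSelf-or-anc : ∀ {u x w} → StrictAnc p x w → DescOrSelf p u w → DescOrSelf p u x ⊎ StrictAnc p x u
  descOrSelf-or-anc x<w (inj₁ refl) = inj₂ x<w
  descOrSelf-or-anc x<w (inj₂ u<w) with anc-comparable u<w x<w
  ... | inj₁ refl = inj₁ (inj₁ refl)
  ... | inj₂ (inj₁ u<x) = inj₁ (inj₂ u<x)
  ... | inj₂ (inj₂ x<u) = inj₂ x<u

  depthF-stable : ∀ {m f v} → up p m v ≡ nothing → m ≤ f → depthF p f v ≡ depthF p m v
  depthF-stable {zero} {zero} _ _ = refl
  depthF-stable {zero} {suc f} {v} e _ rewrite e = refl
  depthF-stable {suc m} {suc f} {v} e (s≤s m≤f) with p v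
  ... | nothing = refl
  ... | just u = cong suc (depthF-stable e m≤f)

  depthF-parent : ∀ f {b c} → p b ≡ just c → up p f b ≡ nothing → depthF p f b ≡ suc (depthF p f c)
  depthF-parent zero e nb with () ← trans (sym e) nb
  depthF-parent (suc f) {b} e nb with p b | e
  ... | just c | refl = cong suc (sym (depthF-stable nb (ℕ.n≤1+n f)))

  depth-parent : ∀ {b c} → p b ≡ just c → depth p b ≡ suc (depth p c)
  depth-parent {b} e = depthF-parent n e (acyclic b)

  depth-up : ∀ m {a b} → up p m b ≡ just a → depth p a < depth p b
  depth-up zero e = ℕ.≤-reflexive (sym (depth-parent e))
  depth-up (suc m) {b = b} e with p b in eb
  ... | just c = ℕ.<-trans (depth-up m e) (ℕ.≤-reflexive (sym (depth-parent eb)))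

  depth-anc : ∀ {a b} → StrictAnc p a b → depth p a < depth p b
  depth-anc (m , e) = depth-up m e

  depthF-just : ∀ f {m v} → m < depthF p f v → ∃ λ a → up p m v ≡ just a
  depthF-just (suc f) {zero} {v} lt with p v
  ... | just u = u , refl
  depthF-just (suc f) {suc m} {v} lt with p v
  ... | just u = depthF-just f (ℕ.s≤s⁻¹ lt)

  private
    module PathToRoot {v} (n≤depth : n ≤ depth p v) where
      up-defined : ∀ (i : Fin n) → ∃ λ a → up p (toℕ i) v ≡ just a
      up-defined i = depthF-just n (ℕ.≤-trans (toℕ<n i) n≤depth)

      path : Fin (suc n) → Fin n
      path zero = v
      path (suc i) = proj₁ (up-defined i)

      path-ascends : ∀ {i j} → i Fin.< j → StrictAnc p (path j) (path i)
      path-ascends {zero} {suc j} _ = toℕ j , proj₂ (up-defined j)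
      path-ascends {suc i} {suc j} i<j =
        up-later (proj₂ (up-defined i)) (proj₂ (up-defined j)) (ℕ.s≤s⁻¹ i<j)

  -- a vertex of depth n would have n + 1 distinct vertices on its path to the root
  depth<n : ∀ v → depth p v < n
  depth<n v = ℕ.≰⇒> λ n≤depth → let open PathToRoot n≤depth in
    case pigeonhole (ℕ.n<1+n n) path of λ where
      (i , j , i<j , pathᵢ≡pathⱼ) → anc-irrefl (subst (StrictAnc p _) pathᵢ≡pathⱼ (path-ascends i<j))

  private
    level : ℕ → List (Fin n)
    level d = filter (λ v → depth p v ℕ.≟ d) (allFin n)

    level-depth : ∀ d → All (λ v → depth p v ≡ d) (level d)
    level-depth d = All.all-filter (λ v → depth p v ℕ.≟ d) (allFin n)

    DepthSorted : List (Fin n) → Set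
    DepthSorted = AllPairs (λ a b → depth p a ≤ depth p b)

    level-sorted : ∀ {d xs} → All (λ v → depth p v ≡ d) xs → DepthSorted xs
    level-sorted [] = []
    level-sorted (e ∷ es) = All.map (λ e′ → ℕ.≤-reflexive (trans e (sym e′))) es ∷ level-sorted es

  bfs-complete : ∀ v → v ∈ bfs p
  bfs-complete v = ∈.∈-concatMap⁺ level
    (Any.map (λ {d} → ∈.∈-filter⁺ (λ w → depth p w ℕ.≟ d) (∈.∈-allFin v)) (∈.∈-upTo⁺ (depth<n v)))

  bfs-sorted : DepthSorted (bfs p)
  bfs-sorted = AllPairs.concat⁺ (All.map⁺ (All.universal (level-sorted ∘ level-depth) (upTo n)))
                                (AllPairs.map⁺ (AllPairs.applyUpTo⁺₁ (λ d → d) n across))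
    where
    across : ∀ {i j} → i < j → j < n → All (λ a → All (λ b → depth p a ≤ depth p b) (level j)) (level i)
    across i<j _ = All.map (λ a∈i → All.map (λ b∈j → subst₂ _≤_ (sym a∈i) (sym b∈j) (ℕ.<⇒≤ i<j))
                                           (level-depth _))
                           (level-depth _)

  bfs-follows : SuccessorsFollow (StrictAnc p) (bfs p)
  bfs-follows = successors-follow (λ a≤b b<a → ℕ.<⇒≱ (depth-anc b<a) a≤b) anc-irrefl bfs-sorted
                                  (λ _ _ → bfs-complete _)

  reverse-bfs-follows : SuccessorsFollow (flip (StrictAnc p)) (reverse (bfs p))
  reverse-bfs-follows = successors-follow (λ b≤a a<b → ℕ.<⇒≱ (depth-anc a<b) b≤a) anc-irrefl
                          (AllPairs-reverse bfs-sorted) (λ _ _ → Any.reverse⁺ (bfs-complete _))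

module _ {n} {Step : Fin n → Labeling n → Labeling n → Set} where

  run-exists : (∀ u {lab} → Injective _≡_ _≡_ lab →
                ∃ λ lab′ → Step u lab lab′ × Injective _≡_ _≡_ lab′) →
               ∀ xs {lab} → Injective _≡_ _≡_ lab → ∃ (Run Step xs lab)
  run-exists next [] _ = _ , done
  run-exists next (u ∷ xs) inj with next u inj
  ... | _ , st , inj′ with run-exists next xs inj′
  ...   | _ , run = _ , step st run

  run-preserves : ∀ {R : Fin n → Fin n → Set} (Inv : Labeling n → List (Fin n) → Set) →
    (∀ {u post lab lab′} → (∀ {x} → R u x → x ∈ post) → Step u lab lab′ →
       Inv lab (u ∷ post) → Inv lab′ post) →
    ∀ {xs lab lab″} → SuccessorsFollow R xs → Run Step xs lab lab″ → Inv lab xs → Inv lab″ []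
  run-preserves Inv preserve [] done inv = inv
  run-preserves Inv preserve (follows ∷ followss) (step st run) inv =
    run-preserves Inv preserve followss run (preserve follows st inv)

module _ {n : ℕ} (Good : Labeling n → Fin n → Set) where

  PendingOrGood : Labeling n → List (Fin n) → Set
  PendingOrGood lab pending = Injective _≡_ _≡_ lab × (∀ x → x ∈ pending ⊎ Good lab x)

  invariant-start : ∀ {lab} {xs : List (Fin n)} → Injective _≡_ _≡_ lab → (∀ x → x ∈ xs) →
                    PendingOrGood lab xs
  invariant-start inj complete = inj , inj₁ ∘ complete

  invariant-end : ∀ {lab} → PendingOrGood lab [] → ∀ x → Good lab x
  invariant-end (_ , inv) x with inv x
  ... | inj₂ good = good

  unchanged-step : ∀ {u post lab} → Good lab u →
                   PendingOrGood lab (u ∷ post) → PendingOrGood lab post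
  unchanged-step good-u (inj , inv) = inj , λ x → case inv x of λ where
    (inj₁ (here refl)) → inj₂ good-u
    (inj₁ (there x∈))  → inj₁ x∈
    (inj₂ good)        → inj₂ good

module Relabelling {n : ℕ} (p : Parent n) (acyclic : ∀ v → up p n v ≡ nothing) where
  open Ancestry p acyclic

  data Position (v w : Fin n) : Set where
    self    : w ≡ v → Position v w
    below   : StrictAnc p v w → Position v w
    outside : ¬ DescOrSelf p v w → Position v w

  position : ∀ v w → Position v w
  position v w with w Fin.≟ v | anc? v w
  ... | yes w≡v | _       = self w≡v
  ... | no _    | yes v<w = below v<w
  ... | no w≢v  | no v≮w  = outside λ { (inj₁ w≡v) → w≢v w≡v ; (inj₂ v<w) → v≮w v<w }

  outside-ancestor-unchanged : ∀ {lab v t lab′ x a} → RelabelSubtree p lab v t lab′ →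
                               ¬ DescOrSelf p v x → StrictAnc p a x → lab′ a ≡ lab a
  outside-ancestor-unchanged (_ , at-outside , _) x∉ a<x =
    at-outside _ (x∉ ∘ λ a∈ → descOrSelf-anc-trans a∈ a<x)

  module _ {lab : Labeling n} (inj : Injective _≡_ _≡_ lab) {v : Fin n} where

    InL? : ∀ ℓ → Dec (InL p lab v ℓ)
    InL? ℓ = any? λ w → desc? v w ×-dec (lab w Fin.≟ ℓ)

    outside∉InL : ∀ {w} → ¬ DescOrSelf p v w → ¬ InL p lab v (lab w)
    outside∉InL w∉ (_ , w′∈ , lab-eq) with inj lab-eq
    ... | refl = w∉ w′∈

    strict-label : ∀ {c} → InL p lab v c → c ≢ lab v → ∃ λ w → StrictAnc p v w × lab w ≡ c
    strict-label (_ , inj₁ refl , refl) c≢ = ⊥-elim (c≢ refl)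
    strict-label (w , inj₂ v<w , e) _ = w , v<w , e

    relabelled-inside : ∀ {t lab′ w} → InL p lab v t → RelabelSubtree p lab v t lab′ →
                        DescOrSelf p v w → InL p lab v (lab′ w)
    relabelled-inside t∈ (at-v , _) (inj₁ refl) = subst (InL p lab v) (sym at-v) t∈
    relabelled-inside _ (_ , _ , at-below , _) (inj₂ v<w) = proj₁ (at-below _ v<w)

    relabelled-label-below : ∀ {t lab′ x w} → InL p lab v t → RelabelSubtree p lab v t lab′ →
                             ¬ DescOrSelf p v x → StrictAnc p x w →
                             ∃ λ w₀ → StrictAnc p x w₀ × lab w₀ ≡ lab′ w
    relabelled-label-below {w = w} t∈ rs@(_ , at-outside , _) x∉ x<w with desc? v w
    ... | no w∉ = w , x<w , sym (at-outside w w∉)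
    ... | yes w∈ with relabelled-inside t∈ rs w∈ | descOrSelf-or-anc x<w w∈
    ...   | _ | inj₁ x∈ = ⊥-elim (x∉ x∈)
    ...   | w₀ , w₀∈ , lab-w₀ | inj₂ x<v = w₀ , anc-descOrSelf-trans x<v w₀∈ , lab-w₀

    relabelSubtree-injective : ∀ {t lab′} → InL p lab v t → RelabelSubtree p lab v t lab′ →
                               Injective _≡_ _≡_ lab′
    relabelSubtree-injective {t} {lab′} t∈ rs@(at-v , at-outside , at-below , mono) {a} {b} eq
      with desc? v a | desc? v b
    ... | no a∉ | no b∉ = inj (trans (sym (at-outside a a∉)) (trans eq (at-outside b b∉)))
    ... | no a∉ | yes b∈ = ⊥-elim (outside∉InL a∉ (subst (InL p lab v) (trans (sym eq) (at-outside a a∉))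
                                                             (relabelled-inside t∈ rs b∈)))
    ... | yes a∈ | no b∉ = ⊥-elim (outside∉InL b∉ (subst (InL p lab v) (trans eq (at-outside b b∉))
                                                             (relabelled-inside t∈ rs a∈)))
    ... | yes (inj₁ refl) | yes (inj₁ refl) = refl
    ... | yes (inj₁ refl) | yes (inj₂ v<b) = ⊥-elim (proj₂ (at-below b v<b) (trans (sym eq) at-v))
    ... | yes (inj₂ v<a) | yes (inj₁ refl) = ⊥-elim (proj₂ (at-below a v<a) (trans eq at-v))
    ... | yes (inj₂ v<a) | yes (inj₂ v<b) with <-cmp (lab a) (lab b)
    ...   | tri< a<b _ _ = ⊥-elim (<-irrefl eq (mono a b v<a v<b a<b))
    ...   | tri≈ _ a≡b _ = inj a≡b
    ...   | tri> _ _ b<a = ⊥-elim (<-irrefl (sym eq) (mono b a v<b v<a b<a))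

    relabelSubtree-exists : ∀ {t} → InL p lab v t → ∃ (RelabelSubtree p lab v t)
    relabelSubtree-exists {t} t∈ with ∖-embedding InL? (v , inj₁ refl , refl) t∈
    ... | g , into , mono = lab′ , at-v , at-outside , at-below , mono-below
      where
      relabel-at : ∀ w → Position v w → Fin n
      relabel-at w (self _)    = t
      relabel-at w (below _)   = g (lab w)
      relabel-at w (outside _) = lab w

      lab′ : Labeling n
      lab′ w = relabel-at w (position v w)

      at-v : lab′ v ≡ t
      at-v with position v v
      ... | self _     = refl
      ... | below v<v  = ⊥-elim (anc-irrefl v<v)
      ... | outside v∉ = ⊥-elim (v∉ (inj₁ refl))

      at-outside : ∀ w → ¬ DescOrSelf p v w → lab′ w ≡ lab w
      at-outside w w∉ with position v w
      ... | self w≡v  = ⊥-elim (w∉ (inj₁ w≡v))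
      ... | below v<w = ⊥-elim (w∉ (inj₂ v<w))
      ... | outside _ = refl

      at-below′ : ∀ w → StrictAnc p v w → lab′ w ≡ g (lab w)
      at-below′ w v<w with position v w
      ... | self w≡v   = ⊥-elim (anc⇒≢ v<w (sym w≡v))
      ... | below _    = refl
      ... | outside w∉ = ⊥-elim (w∉ (inj₂ v<w))

      strict∈L∖lab-v : ∀ {w} → StrictAnc p v w → (InL p lab v ∖ lab v) (lab w)
      strict∈L∖lab-v {w} v<w = (w , inj₂ v<w , refl) , λ e → anc⇒≢ v<w (sym (inj e))

      at-below : ∀ w → StrictAnc p v w → InL p lab v (lab′ w) × lab′ w ≢ t
      at-below w v<w rewrite at-below′ w v<w = into (strict∈L∖lab-v v<w)

      mono-below : ∀ w w′ → StrictAnc p v w → StrictAnc p v w′ →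
                   lab w Fin.< lab w′ → lab′ w Fin.< lab′ w′
      mono-below w w′ v<w v<w′ lt rewrite at-below′ w v<w | at-below′ w′ v<w′ =
        mono (strict∈L∖lab-v v<w) (strict∈L∖lab-v v<w′) lt

  module Shuffled {lab : Labeling n} (inj : Injective _≡_ _≡_ lab) {u x : Fin n} {lab′ : Labeling n}
                  (x-max : IsMaxL p lab u x) (rs : RelabelSubtree p lab u x lab′) where
    private
      at-below = proj₁ (proj₂ (proj₂ rs))
      mono = proj₂ (proj₂ (proj₂ rs))

      descend : ∀ {w} → StrictAnc p u w → lab′ w ≢ lab u → ∃ λ w″ → StrictAnc p u w″ × lab w″ ≡ lab′ w
      descend u<w ≢lab-u = strict-label inj (proj₁ (at-below _ u<w)) ≢lab-u

    below-max : ∀ {w} → StrictAnc p u w → lab′ w Fin.< x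
    below-max {w} u<w = ≤∧≢⇒< (proj₂ x-max (lab′ w) (proj₁ (at-below w u<w))) (proj₂ (at-below w u<w))

    -- were lab u ≤ lab′ w, no label above lab u could decrease, yet the vertex labelled x must drop
    stays-below : ∀ {w} → StrictAnc p u w → lab w Fin.< lab u → lab′ w Fin.< lab u
    stays-below {w} u<w w<u = ℕ.≰⇒> impossible
      where
      Above : Fin n → Set
      Above w′ = StrictAnc p u w′ × lab u Fin.< lab w′

      impossible : lab u Fin.≤ lab′ w → ⊥
      impossible u≤lab′w = x-lost (proj₁ x-max)
        where
        closed : ∀ {w′} → Above w′ → lab′ w′ Fin.< lab w′ → ∃ λ w″ → Above w″ × lab w″ ≡ lab′ w′
        closed {w′} (u<w′ , u<lab-w′) _ =
          let lab′-above = ℕ.≤-<-trans u≤lab′w (mono w w′ u<w u<w′ (<-trans w<u u<lab-w′)) in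
          case descend u<w′ (λ e → <-irrefl (sym e) lab′-above) of λ where
            (w″ , u<w″ , e) → w″ , (u<w″ , subst (lab u Fin.<_) (sym e) lab′-above) , e

        grows : ∀ {w′} → Above w′ → ¬ lab′ w′ Fin.< lab w′
        grows = no-descent <-wellFounded lab lab′ (λ (u<w₁ , _) (u<w₂ , _) → mono _ _ u<w₁ u<w₂) closed

        x-lost : InL p lab u x → ⊥
        x-lost (_ , inj₁ refl , refl) = ℕ.<⇒≱ (below-max u<w) u≤lab′w
        x-lost (wₓ , inj₂ u<wₓ , refl) =
          grows (u<wₓ , ≤∧≢⇒< (proj₂ x-max (lab u) (u , inj₁ refl , refl)) (λ e → anc⇒≢ u<wₓ (inj e)))
                (below-max u<wₓ)

    fixed-below : ∀ {w} → StrictAnc p u w → lab w Fin.< lab u → lab′ w ≡ lab w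
    fixed-below {w} u<w w<u = toℕ-injective (ℕ.≤-antisym (ℕ.≮⇒≥ (no-increase (u<w , w<u)))
                                                         (ℕ.≮⇒≥ (no-decrease (u<w , w<u))))
      where
      Below : Fin n → Set
      Below w′ = StrictAnc p u w′ × lab w′ Fin.< lab u

      closed : ∀ {w′} → Below w′ → lab′ w′ Fin.< lab u → ∃ λ w″ → Below w″ × lab w″ ≡ lab′ w′
      closed (u<w′ , _) lab′<u with descend u<w′ (λ e → <-irrefl e lab′<u)
      ... | w″ , u<w″ , e = w″ , (u<w″ , subst (Fin._< lab u) (sym e) lab′<u) , e

      no-decrease : ∀ {w′} → Below w′ → ¬ lab′ w′ Fin.< lab w′
      no-decrease = no-descent <-wellFounded {P = Below} lab lab′
                      (λ (u<w₁ , _) (u<w₂ , _) → mono _ _ u<w₁ u<w₂)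
                      λ (u<w′ , w′<u) lt → closed (u<w′ , w′<u) (<-trans lt w′<u)

      no-increase : ∀ {w′} → Below w′ → ¬ lab′ w′ Fin.> lab w′
      no-increase = no-descent >-wellFounded {P = Below} lab lab′
                      (λ (u<w₁ , _) (u<w₂ , _) → mono _ _ u<w₂ u<w₁)
                      λ (u<w′ , w′<u) _ → closed (u<w′ , w′<u) (stays-below u<w′ w′<u)

module Capping {n : ℕ} (p : Parent n) (acyclic : ∀ v → up p n v ≡ nothing)
               {m : ℕ} (ρ : Fin (suc m) → ℕ) (last-max : ∀ j → ρ (inject₁ j) < ρ (fromℕ m)) where
  open Ancestry p acyclic

  σ : Fin m → ℕ
  σ = ρ ∘ inject₁

  Caps : Labeling n → (Fin m → Fin n) → Fin n → Set
  Caps lab ws v = IsInstance p lab σ ws × (∀ j → StrictAnc p (ws j) v) × (∀ j → lab (ws j) Fin.< lab v)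

  Capped : Labeling n → Fin n → Set
  Capped lab v = ∃ λ ws → Caps lab ws v

  caps-relabel : ∀ {lab lab′ ws v} → (∀ j → lab (ws j) ≡ lab′ (ws j)) → lab v ≡ lab′ v →
                 Caps lab ws v → Caps lab′ ws v
  caps-relabel same same-v ((ord , lbl) , anc , below) =
    (ord , λ a b lt → subst₂ Fin._<_ (same a) (same b) (lbl a b lt)) , anc ,
    λ j → subst₂ Fin._<_ (same j) same-v (below j)

  caps-resp : ∀ {lab ws ws′ v} → (∀ j → ws j ≡ ws′ j) → Caps lab ws v → Caps lab ws′ v
  caps-resp {lab} {v = v} ws≗ws′ ((ord , lbl) , anc , below) =
    ((λ a b lt → subst₂ (StrictAnc p) (ws≗ws′ a) (ws≗ws′ b) (ord a b lt)) ,
     (λ a b lt → subst₂ (λ x y → lab x Fin.< lab y) (ws≗ws′ a) (ws≗ws′ b) (lbl a b lt))) ,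
    (λ j → subst (λ x → StrictAnc p x v) (ws≗ws′ j) (anc j)) ,
    (λ j → subst (λ x → lab x Fin.< lab v) (ws≗ws′ j) (below j))

  capped? : ∀ lab v → Dec (Capped lab v)
  capped? lab v = any-function? m caps-resp λ ws →
    ((all? λ a → all? λ b → (toℕ a ℕ.<? toℕ b) →-dec anc? (ws a) (ws b)) ×-dec
     (all? λ a → all? λ b → (σ a ℕ.<? σ b) →-dec (toℕ (lab (ws a)) ℕ.<? toℕ (lab (ws b))))) ×-dec
    (all? λ j → anc? (ws j) v) ×-dec (all? λ j → toℕ (lab (ws j)) ℕ.<? toℕ (lab v))

  endpoint→capped : ∀ {lab v} → EndpointOf p lab ρ v → Capped lab v
  endpoint→capped {lab} {v} (vs , (ord , lbl) , b , b-last , vs-b)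
    with toℕ-injective {i = b} {j = fromℕ m} (trans (ℕ.suc-injective b-last) (sym (toℕ-fromℕ m)))
  ... | refl = vs ∘ inject₁ , (ord′ , λ a c → lbl (inject₁ a) (inject₁ c)) , anc , below
    where
    inject₁-< : ∀ {a c : Fin m} → toℕ a < toℕ c → toℕ (inject₁ a) < toℕ (inject₁ c)
    inject₁-< {a} {c} = subst₂ _<_ (sym (toℕ-inject₁ a)) (sym (toℕ-inject₁ c))
    ord′ : ∀ a c → toℕ a < toℕ c → StrictAnc p (vs (inject₁ a)) (vs (inject₁ c))
    ord′ a c = ord (inject₁ a) (inject₁ c) ∘ inject₁-<
    anc : ∀ j → StrictAnc p (vs (inject₁ j)) v
    anc j = subst (StrictAnc p _) vs-b
      (ord (inject₁ j) (fromℕ m) (subst₂ _<_ (sym (toℕ-inject₁ j)) (sym (toℕ-fromℕ m)) (toℕ<n j)))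
    below : ∀ j → lab (vs (inject₁ j)) Fin.< lab v
    below j = subst (λ x → lab (vs (inject₁ j)) Fin.< lab x) vs-b
                    (lbl (inject₁ j) (fromℕ m) (last-max j))

  private
    extend : (Fin m → Fin n) → Fin n → Fin (suc m) → Fin n
    extend ws v i with Top.view i
    ... | Top.‵fromℕ     = v
    ... | Top.‵inject₁ j = ws j

    extend-last : ∀ ws v → extend ws v (fromℕ m) ≡ v
    extend-last ws v rewrite Top.view-fromℕ m = refl

  capped→endpoint : ∀ {lab v} → Capped lab v → EndpointOf p lab ρ v
  capped→endpoint {lab} {v} (ws , (ord , lbl) , anc , below) =
    extend ws v , (ord′ , lbl′) , fromℕ m , cong suc (toℕ-fromℕ m) , extend-last ws v
    where
    ord′ : ∀ a b → toℕ a < toℕ b → StrictAnc p (extend ws v a) (extend ws v b)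
    ord′ a b a<b with Top.view a | Top.view b
    ... | Top.‵fromℕ | _ = ⊥-elim (ℕ.<⇒≱ (subst (_< toℕ b) (toℕ-fromℕ m) a<b) (ℕ.s≤s⁻¹ (toℕ<n b)))
    ... | Top.‵inject₁ i | Top.‵fromℕ = anc i
    ... | Top.‵inject₁ i | Top.‵inject₁ j = ord i j (subst₂ _<_ (toℕ-inject₁ i) (toℕ-inject₁ j) a<b)
    lbl′ : ∀ a b → ρ a < ρ b → lab (extend ws v a) Fin.< lab (extend ws v b)
    lbl′ a b ρa<ρb with Top.view a | Top.view b
    ... | Top.‵fromℕ | Top.‵fromℕ = ⊥-elim (ℕ.<-irrefl refl ρa<ρb)
    ... | Top.‵fromℕ | Top.‵inject₁ j = ⊥-elim (ℕ.<-asym ρa<ρb (last-max j))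
    ... | Top.‵inject₁ i | Top.‵fromℕ = below i
    ... | Top.‵inject₁ i | Top.‵inject₁ j = lbl i j ρa<ρb

relabel-self : ∀ (lab : Labeling n) v z → relabel lab v z v ≡ z
relabel-self lab v z rewrite dec-true (v Fin.≟ v) refl = refl

relabel-other : ∀ (lab : Labeling n) {v z w} → w ≢ v → relabel lab v z w ≡ lab w
relabel-other lab {v} {w = w} w≢v rewrite dec-false (w Fin.≟ v) w≢v = refl

relabel-same : ∀ (lab : Labeling n) v w → relabel lab v (lab v) w ≡ lab w
relabel-same lab v w with w Fin.≟ v
... | yes refl = refl
... | no _ = refl

module Traversals {m : ℕ} (τ : Permutation′ (suc (suc m)))
                  (last-max : ∀ j → patBar τ (inject₁ j) < patBar τ (fromℕ m))
                  {n : ℕ} (p : Parent n) (acyclic : ∀ v → up p n v ≡ nothing) where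
  open Ancestry p acyclic
  open Relabelling p acyclic
  open Capping p acyclic (patBar τ) last-max public

  special? : ∀ lab v → Dec (Special τ p lab v)
  special? lab v = Dec.map′ capped→endpoint endpoint→capped (capped? lab v)

  caps-outside : ∀ {lab v t lab′ ws x} → RelabelSubtree p lab v t lab′ → ¬ DescOrSelf p v x →
                 Caps lab′ ws x → Caps lab ws x
  caps-outside rs x∉ caps′@(_ , anc′ , _) =
    caps-relabel (outside-ancestor-unchanged rs x∉ ∘ anc′) (proj₁ (proj₂ rs) _ x∉) caps′

  Dominates : Labeling n → Fin n → Set
  Dominates lab x = ∀ w → StrictAnc p x w → lab w Fin.< lab x

  Capped⇒Dominates : Labeling n → Fin n → Set
  Capped⇒Dominates lab x = Capped lab x → Dominates lab x

  module Shuffle {lab : Labeling n} (inj : Injective _≡_ _≡_ lab) {u x : Fin n} {lab′ : Labeling n}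
                 (u-capped : Capped lab u) (x-max : IsMaxL p lab u x)
                 (rs : RelabelSubtree p lab u x lab′) where
    open Shuffled inj x-max rs
    private
      at-u = proj₁ rs
      at-outside = proj₁ (proj₂ rs)
      mono = proj₂ (proj₂ (proj₂ rs))

    capped-before : ∀ {y} → StrictAnc p u y → Capped lab′ y → Capped lab y
    capped-before {y} u<y (ws , caps′@(_ , anc′ , lower′)) with <-cmp (lab u) (lab y)
    ... | tri< lab-u<lab-y _ _ = let (wsᵤ , inst , anc , lower) = u-capped in
                          wsᵤ , inst , (λ j → anc-trans (anc j) u<y) , λ j → <-trans (lower j) lab-u<lab-y
    ... | tri≈ _ u≡y _ = ⊥-elim (anc⇒≢ u<y (inj u≡y))
    ... | tri> _ _ y<u = ws , caps-relabel kept (fixed-below u<y y<u) caps′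
      where
      -- an instance capping y in lab′ has labels below lab′ y = lab y < lab u, which shuffling fixes
      kept : ∀ j → lab′ (ws j) ≡ lab (ws j)
      kept j with position u (ws j)
      ... | self refl = ⊥-elim (<-asym (lower′ j) (subst (lab′ y Fin.<_) (sym at-u) (below-max u<y)))
      ... | outside wⱼ∉ = at-outside (ws j) wⱼ∉
      ... | below u<wⱼ with <-cmp (lab (ws j)) (lab y)
      ...   | tri< wⱼ<y _ _ = fixed-below u<wⱼ (<-trans wⱼ<y y<u)
      ...   | tri≈ _ wⱼ≡y _ = ⊥-elim (anc⇒≢ (anc′ j) (inj wⱼ≡y))
      ...   | tri> _ _ y<wⱼ = ⊥-elim (<-asym (lower′ j) (mono y (ws j) u<y u<wⱼ y<wⱼ))

    good-u : Capped⇒Dominates lab′ u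
    good-u _ w u<w = subst (lab′ w Fin.<_) (sym at-u) (below-max u<w)

    good-below : ∀ {y} → StrictAnc p u y → Capped⇒Dominates lab y → Capped⇒Dominates lab′ y
    good-below u<y good capped′ w y<w =
      mono w _ (anc-trans u<y y<w) u<y (good (capped-before u<y capped′) w y<w)

    good-outside : ∀ {y} → ¬ DescOrSelf p u y → ¬ StrictAnc p y u →
                   Capped⇒Dominates lab y → Capped⇒Dominates lab′ y
    good-outside {y} y∉ y≮u good (ws , caps′) w y<w =
      subst₂ Fin._<_ (sym (at-outside w w∉)) (sym (at-outside y y∉))
        (good (ws , caps-outside rs y∉ caps′) w y<w)
      where
      w∉ : ¬ DescOrSelf p u w
      w∉ w∈ with descOrSelf-or-anc y<w w∈
      ... | inj₁ y∈ = y∉ y∈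
      ... | inj₂ y<u = y≮u y<u

  alpha-step : ∀ {u post lab lab′} → (∀ {x} → StrictAnc p x u → x ∈ post) → StepAlpha τ p u lab lab′ →
               PendingOrGood Capped⇒Dominates lab (u ∷ post) → PendingOrGood Capped⇒Dominates lab′ post
  alpha-step _ (inj₂ (¬special , refl)) =
    unchanged-step Capped⇒Dominates λ capped → ⊥-elim (¬special (capped→endpoint capped))
  alpha-step {u} ancestors-pending (inj₁ (special , x , x-max , rs)) (inj , inv) =
    relabelSubtree-injective inj (proj₁ x-max) rs , update
    where
    open Shuffle inj (endpoint→capped special) x-max rs
    update : ∀ y → _ ⊎ Capped⇒Dominates _ y
    update y with position u y | inv y
    ... | self refl | _ = inj₂ good-u
    ... | below u<y | inj₁ (here refl) = ⊥-elim (anc-irrefl u<y)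
    ... | below _ | inj₁ (there y∈) = inj₁ y∈
    ... | below u<y | inj₂ good = inj₂ (good-below u<y good)
    ... | outside y∉ | inj₁ (here refl) = ⊥-elim (y∉ (inj₁ refl))
    ... | outside y∉ | inj₁ (there y∈) = inj₁ y∈
    ... | outside y∉ | inj₂ good with anc? y u
    ...   | yes y<u = inj₁ (ancestors-pending y<u)
    ...   | no y≮u = inj₂ (good-outside y∉ y≮u good)

  LeastCap : Labeling n → Fin n → Set
  LeastCap lab u = ∀ ws → Caps lab ws u →
                   ∀ w → StrictAnc p u w → (∀ j → lab (ws j) Fin.< lab w) → lab u Fin.< lab w

  module Antishuffle {lab : Labeling n} (inj : Injective _≡_ _≡_ lab) {u y : Fin n} {lab′ : Labeling n}
                     (y-least : IsLeastSpecialL τ p lab u y) (rs : RelabelSubtree p lab u y lab′) where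
    private
      at-u = proj₁ rs
      at-outside = proj₁ (proj₂ rs)
      at-below = proj₁ (proj₂ (proj₂ rs))

    good-u : LeastCap lab′ u
    good-u ws ((ord , lbl) , anc , _) w u<w ws<w =
      subst (Fin._< lab′ w) (sym at-u) (≤∧≢⇒< y≤ (≢-sym (proj₂ (at-below w u<w))))
      where
      -- relabelling u by lab′ w keeps it special, so y ≤ lab′ w by the choice of y
      kept : ∀ j → lab′ (ws j) ≡ relabel lab u (lab′ w) (ws j)
      kept j = trans (at-outside (ws j) λ wⱼ∈ → anc-irrefl (anc-descOrSelf-trans (anc j) wⱼ∈))
                     (sym (relabel-other lab (anc⇒≢ (anc j))))
      caps-z : Caps (relabel lab u (lab′ w)) ws u
      caps-z = (ord , λ a b lt → subst₂ Fin._<_ (kept a) (kept b) (lbl a b lt)) , anc ,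
               λ j → subst₂ Fin._<_ (kept j) (sym (relabel-self lab u (lab′ w))) (ws<w j)
      y≤ : y Fin.≤ lab′ w
      y≤ = proj₂ (proj₂ y-least) (lab′ w) (proj₁ (at-below w u<w))
                 (capped→endpoint {relabel lab u (lab′ w)} (ws , caps-z))

    good-outside : ∀ {x} → ¬ DescOrSelf p u x → LeastCap lab x → LeastCap lab′ x
    good-outside {x} x∉ good ws caps′@(_ , anc′ , _) w x<w ws<w =
      let (w₀ , x<w₀ , lab-w₀) = relabelled-label-below inj (proj₁ y-least) rs x∉ x<w in
      subst₂ Fin._<_ (sym (at-outside x x∉)) lab-w₀
        (good ws (caps-outside rs x∉ caps′) w₀ x<w₀
              λ j → subst₂ Fin._<_ (outside-ancestor-unchanged rs x∉ (anc′ j)) (sym lab-w₀) (ws<w j))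

  beta-step : ∀ {u post lab lab′} → (∀ {x} → StrictAnc p u x → x ∈ post) → StepBeta τ p u lab lab′ →
              PendingOrGood LeastCap lab (u ∷ post) → PendingOrGood LeastCap lab′ post
  beta-step _ (inj₂ (¬special , refl)) =
    unchanged-step LeastCap λ ws caps → ⊥-elim (¬special (capped→endpoint (ws , caps)))
  beta-step {u} descendants-pending (inj₁ (_ , y , y-least , rs)) (inj , inv) =
    relabelSubtree-injective inj (proj₁ y-least) rs , update
    where
    open Antishuffle inj y-least rs
    update : ∀ x → _ ⊎ LeastCap _ x
    update x with position u x | inv x
    ... | self refl | _ = inj₂ good-u
    ... | below u<x | _ = inj₁ (descendants-pending u<x)
    ... | outside x∉ | inj₁ (here refl) = ⊥-elim (x∉ (inj₁ refl))
    ... | outside x∉ | inj₁ (there x∈) = inj₁ x∈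
    ... | outside x∉ | inj₂ good = inj₂ (good-outside x∉ good)

  alpha-dominates : ∀ {lab₀ lab} → Injective _≡_ _≡_ lab₀ →
                    Run (StepAlpha τ p) (reverse (bfs p)) lab₀ lab → ∀ x → Capped⇒Dominates lab x
  alpha-dominates inj run =
    invariant-end Capped⇒Dominates
      (run-preserves (PendingOrGood Capped⇒Dominates) alpha-step reverse-bfs-follows run
                     (invariant-start Capped⇒Dominates inj (Any.reverse⁺ ∘ bfs-complete)))

  beta-least : ∀ {lab₀ lab} → Injective _≡_ _≡_ lab₀ → Run (StepBeta τ p) (bfs p) lab₀ lab →
               ∀ x → LeastCap lab x
  beta-least inj run =
    invariant-end LeastCap
      (run-preserves (PendingOrGood LeastCap) beta-step bfs-follows run
                     (invariant-start LeastCap inj bfs-complete))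

  shuffle-step : ∀ u {lab} → Injective _≡_ _≡_ lab →
                 ∃ λ lab′ → StepAlpha τ p u lab lab′ × Injective _≡_ _≡_ lab′
  shuffle-step u {lab} inj with special? lab u
  ... | no ¬special = lab , inj₂ (¬special , refl) , inj
  ... | yes special with greatest (InL? inj) (lab u , u , inj₁ refl , refl)
  ...   | x , x∈ , x-max with relabelSubtree-exists inj x∈
  ...     | lab′ , rs = lab′ , inj₁ (special , x , (x∈ , λ _ → x-max) , rs) ,
                        relabelSubtree-injective inj x∈ rs

  special-relabel-same : ∀ {lab u} → Special τ p lab u → Special τ p (relabel lab u (lab u)) u
  special-relabel-same {lab} {u} special with endpoint→capped special
  ... | ws , caps = capped→endpoint {relabel lab u (lab u)}
    (ws , caps-relabel {lab} {relabel lab u (lab u)} (sym ∘ relabel-same lab u ∘ ws)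
                       (sym (relabel-same lab u u)) caps)

  antishuffle-step : ∀ u {lab} → Injective _≡_ _≡_ lab →
                     ∃ λ lab′ → StepBeta τ p u lab lab′ × Injective _≡_ _≡_ lab′
  antishuffle-step u {lab} inj with special? lab u
  ... | no ¬special = lab , inj₂ (¬special , refl) , inj
  ... | yes special with least (λ z → InL? inj z ×-dec special? (relabel lab u z) u)
                               (lab u , (u , inj₁ refl , refl) , special-relabel-same special)
  ...   | y , (y∈ , y-special) , y-min with relabelSubtree-exists inj y∈
  ...     | lab′ , rs =
    lab′ , inj₁ (special , y , (y∈ , y-special , λ _ z∈ z-special → y-min (z∈ , z-special)) , rs) ,
    relabelSubtree-injective inj y∈ rs

module FixedTop {m : ℕ} (τ : Permutation′ (suc (suc m)))
                (fix-m : ∀ i → toℕ i ≡ m → toℕ (τ ⟨$⟩ʳ i) ≡ m)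
                (fix-suc-m : ∀ i → toℕ i ≡ suc m → toℕ (τ ⟨$⟩ʳ i) ≡ suc m) where

  ι : Fin (suc m) → Fin (suc (suc m))
  ι i = Fin.inject≤ i (ℕ.m∸n≤m (suc (suc m)) 1)

  mid top : Fin (suc (suc m))
  mid = ι (fromℕ m)
  top = fromℕ (suc m)

  toℕ-ι-inject₁ : ∀ j → toℕ (ι (inject₁ j)) ≡ toℕ j
  toℕ-ι-inject₁ j = trans (toℕ-inject≤ (inject₁ j) _) (toℕ-inject₁ j)

  toℕ-mid : toℕ mid ≡ m
  toℕ-mid = trans (toℕ-inject≤ (fromℕ m) _) (toℕ-fromℕ m)

  toℕ-top : toℕ top ≡ suc m
  toℕ-top = toℕ-fromℕ (suc m)

  pat-mid : pat τ mid ≡ m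
  pat-mid = fix-m mid toℕ-mid

  pat-top : pat τ top ≡ suc m
  pat-top = fix-suc-m top toℕ-top

  pat-injective : ∀ {i j} → pat τ i ≡ pat τ j → toℕ i ≡ toℕ j
  pat-injective e = cong toℕ (Injection.injective (↔⇒↣ τ) (toℕ-injective e))

  pat-below : ∀ i → toℕ i < m → pat τ i < m
  pat-below i i<m = ℕ.≤∧≢⇒< (ℕ.s≤s⁻¹ (ℕ.≤∧≢⇒< (ℕ.s≤s⁻¹ (toℕ<n (τ ⟨$⟩ʳ i))) ≢suc-m)) ≢m
    where
    ≢m : pat τ i ≢ m
    ≢m e = ℕ.<⇒≢ i<m (trans (pat-injective (trans e (sym pat-mid))) toℕ-mid)
    ≢suc-m : pat τ i ≢ suc m
    ≢suc-m e = ℕ.<⇒≢ (ℕ.m<n⇒m<1+n i<m) (trans (pat-injective (trans e (sym pat-top))) toℕ-top)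

  σ-below : ∀ j → patBar τ (inject₁ j) < m
  σ-below j = pat-below (ι (inject₁ j)) (subst (_< m) (sym (toℕ-ι-inject₁ j)) (toℕ<n j))

  last-max : ∀ j → patBar τ (inject₁ j) < patBar τ (fromℕ m)
  last-max j = subst (patBar τ (inject₁ j) <_) (sym pat-mid) (σ-below j)

  patTilde-low : ∀ i → toℕ i < m → patTilde τ i ≡ pat τ i
  patTilde-low i i<m rewrite dec-false (toℕ i ℕ.≟ m) (ℕ.<⇒≢ i<m)
                           | dec-false (toℕ i ℕ.≟ suc m) (ℕ.<⇒≢ (ℕ.m<n⇒m<1+n i<m)) = refl

  patTilde-mid : patTilde τ mid ≡ suc m
  patTilde-mid rewrite dec-true (toℕ mid ℕ.≟ m) toℕ-mid = refl

  patTilde-top : patTilde τ top ≡ m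
  patTilde-top rewrite dec-false (toℕ top ℕ.≟ m) (ℕ.1+n≢n ∘ trans (sym toℕ-top))
                     | dec-true (toℕ top ℕ.≟ suc m) toℕ-top = refl

  module Avoidance {n} (p : Parent n) (acyclic : ∀ v → up p n v ≡ nothing) where
    open Traversals τ last-max p acyclic

    prefix-caps : ∀ {π : Fin (suc (suc m)) → ℕ} {lab vs} → (∀ j → π (ι (inject₁ j)) ≡ σ j) →
                  (∀ j → σ j < π mid) → IsInstance p lab π vs → Caps lab (vs ∘ ι ∘ inject₁) (vs mid)
    prefix-caps {π} {lab} {vs} π≡σ σ<π (ord , lbl) =
      (ord′ , λ a b σa<σb → lbl _ _ (subst₂ _<_ (sym (π≡σ a)) (sym (π≡σ b)) σa<σb)) ,
      (λ j → ord _ _ (subst₂ _<_ (sym (toℕ-ι-inject₁ j)) (sym toℕ-mid) (toℕ<n j))) ,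
      (λ j → lbl _ _ (subst (_< π mid) (sym (π≡σ j)) (σ<π j)))
      where
      ord′ : ∀ a b → toℕ a < toℕ b → StrictAnc p (vs (ι (inject₁ a))) (vs (ι (inject₁ b)))
      ord′ a b = ord _ _ ∘ subst₂ _<_ (sym (toℕ-ι-inject₁ a)) (sym (toℕ-ι-inject₁ b))

    private
      mid-before-top : toℕ mid < toℕ top
      mid-before-top = subst₂ _<_ (sym toℕ-mid) (sym toℕ-top) (ℕ.n<1+n m)

    -- mid is special (it caps the prefix) but has the larger descendant top
    dominating⇒avoids : ∀ {lab} → (∀ x → Capped⇒Dominates lab x) → Avoids p lab (pat τ)
    dominating⇒avoids {lab} good (vs , ord , lbl) = <-asym top<mid mid<top
      where
      mid<top : lab (vs mid) Fin.< lab (vs top)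
      mid<top = lbl mid top (subst₂ _<_ (sym pat-mid) (sym pat-top) (ℕ.n<1+n m))
      caps : Caps lab (vs ∘ ι ∘ inject₁) (vs mid)
      caps = prefix-caps {pat τ} {lab} {vs} (λ _ → refl)
               (λ j → subst (σ j <_) (sym pat-mid) (σ-below j)) (ord , lbl)
      top<mid : lab (vs top) Fin.< lab (vs mid)
      top<mid = good (vs mid) (_ , caps) (vs top) (ord _ _ mid-before-top)

    -- top lies above the prefix, so it could replace mid in capping it, yet carries the smaller label
    least⇒avoids : ∀ {lab} → (∀ x → LeastCap lab x) → Avoids p lab (patTilde τ)
    least⇒avoids {lab} good (vs , ord , lbl) = <-asym top<mid mid<top
      where
      low : ∀ j → patTilde τ (ι (inject₁ j)) ≡ σ j
      low j = patTilde-low _ (subst (_< m) (sym (toℕ-ι-inject₁ j)) (toℕ<n j))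
      top<mid : lab (vs top) Fin.< lab (vs mid)
      top<mid = lbl top mid (subst₂ _<_ (sym patTilde-top) (sym patTilde-mid) (ℕ.n<1+n m))
      caps : Caps lab (vs ∘ ι ∘ inject₁) (vs mid)
      caps = prefix-caps {patTilde τ} {lab} {vs} low
               (λ j → subst (σ j <_) (sym patTilde-mid) (ℕ.m<n⇒m<1+n (σ-below j))) (ord , lbl)
      mid<top : lab (vs mid) Fin.< lab (vs top)
      mid<top = good (vs mid) _ caps (vs top) (ord _ _ mid-before-top)
                     (λ j → lbl _ top (subst₂ _<_ (sym (low j)) (sym patTilde-top) (σ-below j)))

lemma4p6 : (k : ℕ) → 3 ≤ k → (τ : Permutation′ k) →
    (∀ (i : Fin k) → toℕ i ≡ k ∸ 2 → toℕ (τ ⟨$⟩ʳ i) ≡ k ∸ 2) →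
    (∀ (i : Fin k) → toℕ i ≡ k ∸ 1 → toℕ (τ ⟨$⟩ʳ i) ≡ k ∸ 1) →
    (n : ℕ) (F : Forest n) →
    ((∃ λ lab → Alpha τ F lab) × (∀ lab → Alpha τ F lab → Avoids (parent F) lab (pat τ))) ×
    ((∃ λ lab → Beta τ F lab) × (∀ lab → Beta τ F lab → Avoids (parent F) lab (patTilde τ)))
lemma4p6 (suc (suc (suc _))) (s≤s (s≤s (s≤s _))) τ fix-m fix-suc-m n F =
  (run-exists shuffle-step _ label-injective ,
   λ _ run → dominating⇒avoids (alpha-dominates label-injective run)) ,
  (run-exists antishuffle-step _ label-injective ,
   λ _ run → least⇒avoids (beta-least label-injective run))
  where
  open FixedTop τ fix-m fix-suc-m
  open Traversals τ last-max (parent F) (acyclic F)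
  open Avoidance (parent F) (acyclic F)
  label-injective : Injective _≡_ _≡_ (label F ⟨$⟩ʳ_)
  label-injective = Injection.injective (↔⇒↣ (label F))
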